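{- Let $M$ be a $4\times3$ matrix with entries in $\{0,1\}$, with rows indexed by $a,b,c,d$ and columns indexed by $1,2,3$. Suppose that for each of the three row-triples $\{a,b,c\}$, $\{a,b,d\}$, $\{a,c,d\}$, the $3\times3$ submatrix on those rows has the property that for every bijection $\tau$ from the three rows to the three columns, $\sum_{r}M_{r,\tau(r)}=1$ (sum over the three rows $r$ of the triple). Then one of the following holds: (i) the $a$-row consists entirely of $1$s and the rows $b,c,d$ consist entirely of $0$s; or (ii) one column consists entirely of $1$s and the other two columns consist entirely of $0$s. -}

module Defs where

open import Data.Nat using (ℕ; _+_; _≤_)
open import Data.Fin using (Fin; zero; suc)
open import Data.Fin.Permutation using (Permutation′; _⟨$⟩ʳ_)
open import Data.Product using (_×_; ∃)
open import Data.Sum using (_⊎_)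
open import Relation.Binary.PropositionalEquality using (_≡_)

-- Rows: a = 0, b = 1, c = 2, d = 3.  Columns: 1,2,3 = 0,1,2.
Matrix : Set
Matrix = Fin 4 → Fin 3 → ℕ

ZeroOne : Matrix → Set
ZeroOne M = ∀ r j → M r j ≤ 1

rowA rowB rowC rowD : Fin 4
rowA = zero
rowB = suc zero
rowC = suc (suc zero)
rowD = suc (suc (suc zero))

Triple : Set
Triple = Fin 3 → Fin 4

mkTriple : Fin 4 → Fin 4 → Fin 4 → Triple
mkTriple x y z zero = x
mkTriple x y z (suc zero) = y
mkTriple x y z (suc (suc zero)) = z

-- Sum over the three rows ρ i of M (ρ i) (τ (ρ i)); a bijection τ from the
-- rows of the triple to the columns is represented (via the enumeration ρ)
-- by a permutation σ of Fin 3, with τ (ρ i) = σ i.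
transversalSum : Matrix → Triple → Permutation′ 3 → ℕ
transversalSum M ρ σ =
  M (ρ zero) (σ ⟨$⟩ʳ zero)
  + M (ρ (suc zero)) (σ ⟨$⟩ʳ suc zero)
  + M (ρ (suc (suc zero))) (σ ⟨$⟩ʳ suc (suc zero))

AllTransversalsOne : Matrix → Triple → Set
AllTransversalsOne M ρ = ∀ (σ : Permutation′ 3) → transversalSum M ρ σ ≡ 1

Conclusion₁ : Matrix → Set
Conclusion₁ M = (∀ j → M rowA j ≡ 1) × (∀ r → r ≡ rowA ⊎ (∀ j → M r j ≡ 0))

Conclusion₂ : Matrix → Set
Conclusion₂ M = ∃ λ (k : Fin 3) → (∀ r → M r k ≡ 1) × (∀ j → j ≡ k ⊎ (∀ r → M r j ≡ 0))

-- That all six transversals of three 0/1 rows sum to 1 forces the 3 × 3 block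
-- to be a single full line: one row of ones, or one column of ones, and zeros
-- elsewhere.  The three blocks share row a.  If row a is all ones, every block
-- is of the first kind with b, c, d zero; if row a is a unit vector e_k, every
-- block is column k.  If row a is zero, the blocks make exactly one of b, c, one
-- of b, d and one of c, d a row of ones, impossible on the odd cycle b, c, d.
module Submission where

open import Defs
open import Data.Nat using (ℕ; _+_)
open import Data.Fin using (Fin; zero; suc; #_)
open import Data.Fin.Permutation using (Permutation′; _⟨$⟩ʳ_; id; transpose; _∘ₚ_)
open import Data.Vec using (Vec; []; _∷_; lookup; tabulate)
open import Data.Vec.Properties using (lookup∘tabulate)
open import Data.Product using (_,_)
open import Data.Sum using (_⊎_; inj₁; inj₂)
import Data.Sum as Sum
open import Function using (_∘_)
open import Relation.Binary.PropositionalEquality using (_≡_; refl; sym; trans; cong)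

data ExactlyOne : ℕ → ℕ → ℕ → Set where
  first  : ExactlyOne 1 0 0
  second : ExactlyOne 0 1 0
  third  : ExactlyOne 0 0 1

exactlyOne : ∀ x y z → x + y + z ≡ 1 → ExactlyOne x y z
exactlyOne 1 0 0 refl = first
exactlyOne 0 1 0 refl = second
exactlyOne 0 0 1 refl = third

Row : Set
Row = Vec ℕ 3

ones zeros : Row
ones  = 1 ∷ 1 ∷ 1 ∷ []
zeros = 0 ∷ 0 ∷ 0 ∷ []

unit : Fin 3 → Row
unit zero             = 1 ∷ 0 ∷ 0 ∷ []
unit (suc zero)       = 0 ∷ 1 ∷ 0 ∷ []
unit (suc (suc zero)) = 0 ∷ 0 ∷ 1 ∷ []

-- Shapes are indexed by literal rows so that matching on them lets the
-- unifier do the case analysis: the coverage checker discards every other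
-- combination of cases in rowOrColumn and rowAOrColumn.  The columns get one constructor each because
-- unification gets stuck on unit k for a variable k.
data RowOrColumn : Row → Row → Row → Set where
  row₀    : RowOrColumn ones zeros zeros
  row₁    : RowOrColumn zeros ones zeros
  row₂    : RowOrColumn zeros zeros ones
  column₀ : RowOrColumn (unit (# 0)) (unit (# 0)) (unit (# 0))
  column₁ : RowOrColumn (unit (# 1)) (unit (# 1)) (unit (# 1))
  column₂ : RowOrColumn (unit (# 2)) (unit (# 2)) (unit (# 2))

data RowAOrColumn : Row → Row → Row → Row → Set where
  onesRowA : RowAOrColumn ones zeros zeros zeros
  column   : ∀ k → RowAOrColumn (unit k) (unit k) (unit k) (unit k)

private
  variable
    u₀ u₁ u₂ v₀ v₁ v₂ w₀ w₁ w₂ : ℕ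
    a b c d : Row

rowOrColumn : ExactlyOne u₀ v₁ w₂ → ExactlyOne u₀ v₂ w₁ → ExactlyOne u₁ v₀ w₂
            → ExactlyOne u₁ v₂ w₀ → ExactlyOne u₂ v₀ w₁ → ExactlyOne u₂ v₁ w₀
            → RowOrColumn (u₀ ∷ u₁ ∷ u₂ ∷ []) (v₀ ∷ v₁ ∷ v₂ ∷ []) (w₀ ∷ w₁ ∷ w₂ ∷ [])
rowOrColumn first  first  first  first  first  first  = row₀
rowOrColumn second second second second second second = row₁
rowOrColumn third  third  third  third  third  third  = row₂
rowOrColumn first  first  second third  second third  = column₀
rowOrColumn second third  first  first  third  second = column₁
rowOrColumn third  second third  second first  first  = column₂

transversals⇒rowOrColumn : (M : Matrix) (x y z : Fin 4) → AllTransversalsOne M (mkTriple x y z)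
                         → RowOrColumn (tabulate (M x)) (tabulate (M y)) (tabulate (M z))
transversals⇒rowOrColumn M x y z H =
  -- σ = 012, 021, 102, 120, 201, 210 in one-line notation
  rowOrColumn (one id)
              (one (transpose (# 1) (# 2)))
              (one (transpose (# 0) (# 1)))
              (one (transpose (# 1) (# 2) ∘ₚ transpose (# 0) (# 1)))
              (one (transpose (# 0) (# 1) ∘ₚ transpose (# 1) (# 2)))
              (one (transpose (# 0) (# 2)))
  where
  one : (σ : Permutation′ 3)
      → ExactlyOne (M x (σ ⟨$⟩ʳ # 0)) (M y (σ ⟨$⟩ʳ # 1)) (M z (σ ⟨$⟩ʳ # 2))
  one σ = exactlyOne _ _ _ (H σ)

rowAOrColumn : RowOrColumn a b c → RowOrColumn a b d → RowOrColumn a c d → RowAOrColumn a b c d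
rowAOrColumn row₀    row₀    row₀    = onesRowA
rowAOrColumn row₁    row₁    ()
rowAOrColumn row₂    row₂    ()
rowAOrColumn column₀ column₀ column₀ = column (# 0)
rowAOrColumn column₁ column₁ column₁ = column (# 1)
rowAOrColumn column₂ column₂ column₂ = column (# 2)

fromRows : Vec Row 4 → Matrix
fromRows V r j = lookup (lookup V r) j

fromRows-tabulate : (M : Matrix) → ∀ r j → fromRows (tabulate (tabulate ∘ M)) r j ≡ M r j
fromRows-tabulate M r j =
  trans (cong (λ row → lookup row j) (lookup∘tabulate (tabulate ∘ M) r)) (lookup∘tabulate (M r) j)

∀-Fin₃ : {P : Fin 3 → Set} → P (# 0) → P (# 1) → P (# 2) → ∀ j → P j
∀-Fin₃ p₀ p₁ p₂ zero             = p₀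
∀-Fin₃ p₀ p₁ p₂ (suc zero)       = p₁
∀-Fin₃ p₀ p₁ p₂ (suc (suc zero)) = p₂

∀-Fin₄ : {P : Fin 4 → Set} → P (# 0) → P (# 1) → P (# 2) → P (# 3) → ∀ r → P r
∀-Fin₄     p₀ p₁ p₂ p₃ zero    = p₀
∀-Fin₄ {P} p₀ p₁ p₂ p₃ (suc r) = ∀-Fin₃ {P ∘ suc} p₁ p₂ p₃ r

Conclusion : Matrix → Set
Conclusion M = Conclusion₁ M ⊎ Conclusion₂ M

rowAOrColumn⇒conclusion : RowAOrColumn a b c d → Conclusion (fromRows (a ∷ b ∷ c ∷ d ∷ []))
rowAOrColumn⇒conclusion onesRowA =
  inj₁ (∀-Fin₃ refl refl refl , ∀-Fin₄ (inj₁ refl) (inj₂ (∀-Fin₃ refl refl refl))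
                                       (inj₂ (∀-Fin₃ refl refl refl)) (inj₂ (∀-Fin₃ refl refl refl)))
rowAOrColumn⇒conclusion (column zero) =
  inj₂ (# 0 , ∀-Fin₄ refl refl refl refl ,
         ∀-Fin₃ (inj₁ refl) (inj₂ (∀-Fin₄ refl refl refl refl)) (inj₂ (∀-Fin₄ refl refl refl refl)))
rowAOrColumn⇒conclusion (column (suc zero)) =
  inj₂ (# 1 , ∀-Fin₄ refl refl refl refl ,
         ∀-Fin₃ (inj₂ (∀-Fin₄ refl refl refl refl)) (inj₁ refl) (inj₂ (∀-Fin₄ refl refl refl refl)))
rowAOrColumn⇒conclusion (column (suc (suc zero))) =
  inj₂ (# 2 , ∀-Fin₄ refl refl refl refl ,
         ∀-Fin₃ (inj₂ (∀-Fin₄ refl refl refl refl)) (inj₂ (∀-Fin₄ refl refl refl refl)) (inj₁ refl))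

conclusion-resp : {M N : Matrix} → (∀ r j → N r j ≡ M r j) → Conclusion N → Conclusion M
conclusion-resp {M} {N} N≗M = Sum.map resp₁ resp₂
  where
  rowResp : ∀ r {n} → (∀ j → N r j ≡ n) → ∀ j → M r j ≡ n
  rowResp r p j = trans (sym (N≗M r j)) (p j)
  columnResp : ∀ j {n} → (∀ r → N r j ≡ n) → ∀ r → M r j ≡ n
  columnResp j p r = trans (sym (N≗M r j)) (p r)
  resp₁ : Conclusion₁ N → Conclusion₁ M
  resp₁ (onesA , zeroRows) = rowResp rowA onesA , λ r → Sum.map₂ (rowResp r) (zeroRows r)
  resp₂ : Conclusion₂ N → Conclusion₂ M
  resp₂ (k , onesK , zeroColumns) = k , columnResp k onesK , λ j → Sum.map₂ (columnResp j) (zeroColumns j)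

lemma4p2 : (M : Matrix) → ZeroOne M
         → AllTransversalsOne M (mkTriple rowA rowB rowC)
         → AllTransversalsOne M (mkTriple rowA rowB rowD)
         → AllTransversalsOne M (mkTriple rowA rowC rowD)
         → Conclusion₁ M ⊎ Conclusion₂ M
-- ZeroOne is not needed: each entry lies on a transversal, whose sum 1 bounds it.
lemma4p2 M _ abc abd acd =
  conclusion-resp (fromRows-tabulate M) (rowAOrColumn⇒conclusion (rowAOrColumn
    (transversals⇒rowOrColumn M rowA rowB rowC abc)
    (transversals⇒rowOrColumn M rowA rowB rowD abd)
    (transversals⇒rowOrColumn M rowA rowC rowD acd)))
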